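{- Let $G=(V,E)$ be a tolerance graph and $R$ a canonical projection representation of $G$. Then for every unbounded vertex $u$ of $G$ in $R$ there exists a covering vertex $u^{\ast}$ of $u$ in $G$ such that $u^{\ast}$ is bounded in $R$, $P_{u^{\ast}}$ intersects $P_u$ in $R$, and $\phi_{u^{\ast}}<\phi_u$. In particular $V_0(u)\ne\emptyset$.
   Context: Projection representation: fix parallel horizontal lines $L_1$ (upper), $L_2$ (lower). It assigns to each vertex $u$ either (bounded) a parallelogram $P_u$ with upper side $[L(u),R(u)]$ on $L_1$, lower side $[l(u),r(u)]$ on $L_2$, the other two sides parallel, or (unbounded) a segment $P_u$ from $l(u)=r(u)$ on $L_2$ to $L(u)=R(u)$ on $L_1$; $\phi_u\in(0,\pi)$ is the angle of the non-horizontal sides with the positive direction of $L_2$. Induced adjacency: two bounded vertices adjacent iff $P_u\cap P_v\ne\emptyset$; bounded $v$ and unbounded $u$ adjacent iff $P_u\cap P_v\ne\emptyset$ and $\phi_v>\phi_u$; two unbounded never adjacent. $R$ represents $G$ if its induced graph is $G$; endpoints and slopes are distinct. Tolerance graphs are exactly graphs with a projection representation. An unbounded vertex $v$ is inevitable in $R$ if declaring $v$ bounded (keeping the segment $P_v$) would create a new edge, i.e. there is a vertex $x\ne v$ with $P_x\cap P_v\neq\emptyset$, $\phi_x<\phi_v$ and $xv\notin E$; $R$ is canonical if every unbounded vertex is inevitable. $P_x$ intersects $P_y$ means neither lies completely to the left of the other. Covering set $\mathcal C(u)=\{v\in V\setminus N[u]:N(u)\subseteq N(v)\}$ (its elements are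 covering vertices of $u$); $V_0(u)$ is the set of connected components of $G\setminus N[u]$ containing at least one covering vertex of $u$.
   Formalization: The endpoints $L(u)$, $R(u)$, $l(u)$, $r(u)$ of every vertex in the projection representation R are rational numbers. -}

module Defs where

open import Data.Nat using (ℕ)
open import Data.Fin using (Fin)
open import Data.Bool using (Bool; true; false)
open import Data.Rational using (ℚ; _<_; _-_)
open import Data.Product using (_×_; Σ; ∃; ∃-syntax)
open import Data.Empty using (⊥)
open import Relation.Nullary using (¬_)
open import Relation.Binary.PropositionalEquality using (_≡_; _≢_)

record Graph (n : ℕ) : Set₁ where
  field
    Adj     : Fin n → Fin n → Set
    sym     : ∀ {u v} → Adj u v → Adj v u
    irrefl  : ∀ {u} → ¬ Adj u u

-- L1 is the line y = 1, L2 the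
-- line y = 0.  For vertex u: upper side [L u , R u] on L1, lower side
-- [l u , r u] on L2; bounded u = true means P_u is a parallelogram,
-- bounded u = false means P_u is the segment from l u = r u to L u = R u.
record ProjRep (n : ℕ) : Set where
  field
    bounded : Fin n → Bool
    L R l r : Fin n → ℚ
    parallel : ∀ u → R u - r u ≡ L u - l u
    bndUpper : ∀ u → bounded u ≡ true → L u < R u
    bndLower : ∀ u → bounded u ≡ true → l u < r u
    unbUpper : ∀ u → bounded u ≡ false → L u ≡ R u
    unbLower : ∀ u → bounded u ≡ false → l u ≡ r u
    distUpperLL : ∀ u v → u ≢ v → L u ≢ L v
    distUpperLR : ∀ u v → u ≢ v → L u ≢ R v
    distUpperRR : ∀ u v → u ≢ v → R u ≢ R v
    distLowerll : ∀ u v → u ≢ v → l u ≢ l v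
    distLowerlr : ∀ u v → u ≢ v → l u ≢ r v
    distLowerrr : ∀ u v → u ≢ v → r u ≢ r v
    distSlope : ∀ u v → u ≢ v → (L u - l u) ≢ (L v - l v)

module _ {n : ℕ} (Rp : ProjRep n) where
  open ProjRep Rp

  -- Horizontal offset of the non-horizontal sides (= cot φ_u, since the
  -- strip has height 1).  φ_u ∈ (0,π) is strictly decreasing in it.
  offset : Fin n → ℚ
  offset u = L u - l u

  _φ<_ : Fin n → Fin n → Set
  u φ< v = offset v < offset u

  LeftOf : Fin n → Fin n → Set
  LeftOf u v = (R u < L v) × (r u < l v)

  Intersects : Fin n → Fin n → Set
  Intersects u v = ¬ LeftOf u v × ¬ LeftOf v u

  inducedEdge' : Bool → Bool → Fin n → Fin n → Set
  inducedEdge' true  true  u v = Intersects u v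
  inducedEdge' true  false u v = Intersects u v × (v φ< u)
  inducedEdge' false true  u v = Intersects u v × (u φ< v)
  inducedEdge' false false u v = ⊥

  InducedEdge : Fin n → Fin n → Set
  InducedEdge u v = inducedEdge' (bounded u) (bounded v) u v

module _ {n : ℕ} (G : Graph n) (Rp : ProjRep n) where
  open Graph G
  open ProjRep Rp

  Represents : Set
  Represents = ∀ u v → u ≢ v →
    (Adj u v → InducedEdge Rp u v) × (InducedEdge Rp u v → Adj u v)

  Inevitable : Fin n → Set
  Inevitable v = ∃[ x ] (x ≢ v × Intersects Rp x v × _φ<_ Rp x v × ¬ Adj x v)

  Canonical : Set
  Canonical = ∀ v → bounded v ≡ false → Inevitable v

module _ {n : ℕ} (G : Graph n) where
  open Graph G

  CoveringVertex : Fin n → Fin n → Set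
  CoveringVertex u v = v ≢ u × ¬ Adj u v × (∀ w → Adj u w → Adj v w)

{-# OPTIONS --safe #-}
-- Start from the witness x that u is inevitable and repeatedly replace an
-- unbounded vertex z by the witness y of its own inevitability.  If P_z is a
-- segment and φ_y < φ_z, then P_y meeting P_z forces l y ≤ l z and R z ≤ R y,
-- so this relation is transitive along segments: every vertex reached meets
-- P_u with angle below φ_u.  The angles strictly decrease, so the walk stops
-- at a bounded vertex u*.  A neighbour w of u is bounded with φ_u < φ_w,
-- which forces L w ≤ L u and r u ≤ r w; together with l u* ≤ l u and
-- R u ≤ R u* this makes P_{u*} meet P_w, so N(u) ⊆ N(u*).
module Submission where

open import Defs
open import Data.Nat using (ℕ)
open import Data.Fin using (Fin)
open import Data.Fin.Induction using (spo-noetherian)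
open import Data.Bool using (true; false)
open import Data.Product using (_×_; ∃; ∃-syntax; _,_; proj₁; proj₂; swap)
open import Data.Sum using (_⊎_; inj₁; inj₂)
open import Data.Rational using (ℚ; _<_; _≤_; _-_)
open import Data.Rational.Properties
  using (<-isStrictPartialOrder; <-irrefl; <-asym; <-trans; <-≤-trans; ≤-trans;
         ≤-reflexive; <⇒≤; ≮⇒≥; +-mono-<-≤; _≤?_; ≰⇒>; +-0-group)
open import Algebra.Properties.Group +-0-group using (//-rightDividesˡ)
open import Induction.WellFounded using (WellFounded; Acc; acc)
open import Relation.Binary.Core using (Rel)
open import Function using (_∘_)
import Relation.Binary.Construct.On as On
open import Relation.Nullary using (¬_; yes; no; contradiction)
open import Relation.Binary.PropositionalEquality
  using (_≡_; _≢_; refl; sym; subst; subst₂)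

module _ {a p q ℓ} {A : Set a} {_⊏_ : Rel A ℓ} (wf : WellFounded _⊏_)
         {P : A → Set p} {Q : A → Set q} where

  descend-until : (∀ {z} → P z → Q z ⊎ ∃[ y ] (y ⊏ z × P y)) →
                  ∀ {z} → P z → ∃ Q
  descend-until step {z} = go (wf z)
    where
    go : ∀ {z} → Acc _⊏_ z → P z → ∃ Q
    go (acc rs) pz with step pz
    ... | inj₁ qz = _ , qz
    ... | inj₂ (y , y⊏z , py) = go (rs y⊏z) py

x-y<z-w∧y≤w⇒x<z : ∀ {x y z w : ℚ} → x - y < z - w → y ≤ w → x < z
x-y<z-w∧y≤w⇒x<z {x} {y} {z} {w} lt y≤w =
  subst₂ _<_ (//-rightDividesˡ y x) (//-rightDividesˡ w z) (+-mono-<-≤ lt y≤w)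

x-y<z-w∧z≤x⇒w<y : ∀ {x y z w : ℚ} → x - y < z - w → z ≤ x → w < y
x-y<z-w∧z≤x⇒w<y lt z≤x with _ ≤? _
... | yes y≤w = contradiction (<-≤-trans (x-y<z-w∧y≤w⇒x<z lt y≤w) z≤x) (<-irrefl refl)
... | no y≰w = ≰⇒> y≰w

module _ {n : ℕ} (Rp : ProjRep n) where
  open ProjRep Rp

  φ<-wellFounded : WellFounded (_φ<_ Rp)
  φ<-wellFounded = spo-noetherian (On.isStrictPartialOrder (offset Rp) <-isStrictPartialOrder)

  φ<-trans : ∀ {x y z} → _φ<_ Rp x y → _φ<_ Rp y z → _φ<_ Rp x z
  φ<-trans x<y y<z = <-trans y<z x<y

  φ<⇒≢ : ∀ {y z} → _φ<_ Rp y z → y ≢ z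
  φ<⇒≢ lt refl = <-irrefl refl lt

  Intersects-sym : ∀ {y z} → Intersects Rp y z → Intersects Rp z y
  Intersects-sym = swap

  overlap⇒Intersects : ∀ {y z} → L z ≤ R y → l y ≤ r z → Intersects Rp y z
  overlap⇒Intersects Lz≤Ry ly≤rz =
    (λ (Ry<Lz , _) → <-irrefl refl (<-≤-trans Ry<Lz Lz≤Ry)) ,
    (λ (_ , rz<ly) → <-irrefl refl (<-≤-trans rz<ly ly≤rz))

  module _ {z} (z-unbounded : bounded z ≡ false) where

    top-≡ : L z ≡ R z
    top-≡ = unbUpper z z-unbounded

    bottom-≡ : l z ≡ r z
    bottom-≡ = unbLower z z-unbounded

    φ<-crossing-segment-bounds : ∀ {y} → Intersects Rp y z → _φ<_ Rp y z →
                               (l y ≤ l z) × (R z ≤ R y)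
    φ<-crossing-segment-bounds {y} (¬y◁z , ¬z◁y) lt = ≮⇒≥ lz≮ly , ≮⇒≥ Ry≮Rz
      where
      lz≮ly : ¬ (l z < l y)
      lz≮ly lz<ly = ¬z◁y ( subst (_< L y) top-≡ (x-y<z-w∧y≤w⇒x<z lt (<⇒≤ lz<ly))
                         , subst (_< l y) bottom-≡ lz<ly )
      Ry≮Rz : ¬ (R y < R z)
      Ry≮Rz Ry<Rz = ¬y◁z
        ( subst (R y <_) (sym top-≡) Ry<Rz
        , subst (r y <_) (sym bottom-≡)
            (x-y<z-w∧z≤x⇒w<y (subst₂ _<_ (sym (parallel z)) (sym (parallel y)) lt)
                             (<⇒≤ Ry<Rz)) )

    φ>-crossing-segment-bounds : ∀ {y} → Intersects Rp y z → _φ<_ Rp z y →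
                               (L y ≤ L z) × (r z ≤ r y)
    φ>-crossing-segment-bounds {y} (¬y◁z , ¬z◁y) lt = ≮⇒≥ Lz≮Ly , ≮⇒≥ ry≮rz
      where
      Lz≮Ly : ¬ (L z < L y)
      Lz≮Ly Lz<Ly = ¬z◁y ( subst (_< L y) top-≡ Lz<Ly
                         , subst (_< l y) bottom-≡ (x-y<z-w∧z≤x⇒w<y lt (<⇒≤ Lz<Ly)) )
      ry≮rz : ¬ (r y < r z)
      ry≮rz ry<rz = ¬y◁z
        ( subst (R y <_) (sym top-≡)
            (x-y<z-w∧y≤w⇒x<z (subst₂ _<_ (sym (parallel y)) (sym (parallel z)) lt)
                             (<⇒≤ ry<rz))
        , subst (r y <_) (sym bottom-≡) ry<rz )

  φ<-crossing-segment-trans : ∀ {y z u} → bounded z ≡ false → bounded u ≡ false →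
    Intersects Rp y z → _φ<_ Rp y z → Intersects Rp z u → _φ<_ Rp z u → Intersects Rp y u
  φ<-crossing-segment-trans zb ub y∩z y<z z∩u z<u =
    overlap⇒Intersects (≤-trans (≤-reflexive (top-≡ ub)) (≤-trans Ru≤Rz Rz≤Ry))
                       (≤-trans ly≤lz (≤-trans lz≤lu (≤-reflexive (bottom-≡ ub))))
    where
    ly≤lz = proj₁ (φ<-crossing-segment-bounds zb y∩z y<z)
    Rz≤Ry = proj₂ (φ<-crossing-segment-bounds zb y∩z y<z)
    lz≤lu = proj₁ (φ<-crossing-segment-bounds ub z∩u z<u)
    Ru≤Rz = proj₂ (φ<-crossing-segment-bounds ub z∩u z<u)

  intersects-across-segment : ∀ {x u w} → bounded u ≡ false →
    Intersects Rp x u → _φ<_ Rp x u → Intersects Rp w u → _φ<_ Rp u w → Intersects Rp x w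
  intersects-across-segment ub x∩u x<u w∩u u<w =
    overlap⇒Intersects (≤-trans Lw≤Lu (≤-trans (≤-reflexive (top-≡ ub)) Ru≤Rx))
                       (≤-trans lx≤lu (≤-trans (≤-reflexive (bottom-≡ ub)) ru≤rw))
    where
    lx≤lu = proj₁ (φ<-crossing-segment-bounds ub x∩u x<u)
    Ru≤Rx = proj₂ (φ<-crossing-segment-bounds ub x∩u x<u)
    Lw≤Lu = proj₁ (φ>-crossing-segment-bounds ub w∩u u<w)
    ru≤rw = proj₂ (φ>-crossing-segment-bounds ub w∩u u<w)

  InducedEdge-unbounded : ∀ {u w} → bounded u ≡ false → InducedEdge Rp u w →
    bounded w ≡ true × Intersects Rp u w × _φ<_ Rp u w
  InducedEdge-unbounded {u} {w} ub e with bounded u | bounded w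
  InducedEdge-unbounded refl e | false | true = refl , e

  InducedEdge-bounded : ∀ {x w} → bounded x ≡ true → bounded w ≡ true →
    Intersects Rp x w → InducedEdge Rp x w
  InducedEdge-bounded {x} {w} bx bw x∩w with bounded x | bounded w
  InducedEdge-bounded refl refl x∩w | true | true = x∩w

module _ {n : ℕ} (G : Graph n) (Rp : ProjRep n) (rep : Represents G Rp) where
  open Graph G using (Adj; irrefl)
  open ProjRep Rp

  bounded-φ<-crossing⇒covering : ∀ {u x} → bounded u ≡ false → bounded x ≡ true →
    Intersects Rp x u → _φ<_ Rp x u → CoveringVertex G u x
  bounded-φ<-crossing⇒covering {u} {x} ub bx x∩u x<u = φ<⇒≢ Rp x<u , ¬u~x , covers
    where
    ¬u~x : ¬ Adj u x
    ¬u~x u~x = <-asym x<u (proj₂ (proj₂ (InducedEdge-unbounded Rp ub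
                 (proj₁ (rep u x (φ<⇒≢ Rp x<u ∘ sym)) u~x))))
    covers : ∀ w → Adj u w → Adj x w
    covers w u~w with InducedEdge-unbounded Rp ub (proj₁ (rep u w u≢w) u~w)
      where
      u≢w : u ≢ w
      u≢w refl = irrefl u~w
    ... | bw , u∩w , u<w =
      proj₂ (rep x w (φ<⇒≢ Rp (φ<-trans Rp x<u u<w)))
        (InducedEdge-bounded Rp bx bw
          (intersects-across-segment Rp ub x∩u x<u (Intersects-sym Rp u∩w) u<w))

lemma4 : (n : ℕ) (G : Graph n) (Rp : ProjRep n) → Represents G Rp → Canonical G Rp →
    ∀ u → ProjRep.bounded Rp u ≡ false →
    ∃[ u* ] (CoveringVertex G u u* × ProjRep.bounded Rp u* ≡ true ×
             Intersects Rp u* u × _φ<_ Rp u* u)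
lemma4 n G Rp rep can u ub =
  let (u* , bu* , u*∩u , u*<u) = descend-until (φ<-wellFounded Rp) step start
  in u* , bounded-φ<-crossing⇒covering G Rp rep ub bu* u*∩u u*<u , bu* , u*∩u , u*<u
  where
  open ProjRep Rp

  φ<-Crossing : Fin n → Set
  φ<-Crossing z = Intersects Rp z u × _φ<_ Rp z u

  start : φ<-Crossing (proj₁ (can u ub))
  start = let (_ , _ , x∩u , x<u , _) = can u ub in x∩u , x<u

  step : ∀ {z} → φ<-Crossing z →
         (bounded z ≡ true × φ<-Crossing z) ⊎ ∃[ y ] (_φ<_ Rp y z × φ<-Crossing y)
  step {z} z-crosses with bounded z in zb
  ... | true = inj₁ (refl , z-crosses)
  ... | false with can z zb
  ...   | y , _ , y∩z , y<z , _ =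
    let (z∩u , z<u) = z-crosses
    in inj₂ (y , y<z , φ<-crossing-segment-trans Rp zb ub y∩z y<z z∩u z<u
                     , φ<-trans Rp y<z z<u)
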